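{- Let $\Delta\ge 2$ be an integer. Then $\rho(\lceil\sqrt{\Delta}\rceil\text{ -DOMINATE}, \Delta\text{ -BOUNDED}) \leq 3\sqrt{\Delta}$.
   Context: Online dominating set model: an input is a finite, connected, simple, undirected graph $G=(V,E)$ together with an ordering $v_1,\dots,v_n$ of $V$ chosen by an adversary such that for every $i$ the subgraph induced on $\{v_1,\dots,v_i\}$ is connected. At step $i$, $v_i$ is revealed together with its entire closed neighbourhood $N[v_i]$, and the algorithm irrevocably decides whether to select $v_i$; the selected set must dominate $G$. $ALG$ is the number of selected vertices, $OPT$ the minimum dominating set size; $\rho(ALG,\mathrm{CLASS})$ is the infimum of all $c$ with $\limsup_{OPT\to\infty} ALG/OPT\le c$ over inputs with graph in CLASS. $\Delta$-BOUNDED is the class of graphs in which every vertex has degree at most $\Delta$; the integer $\Delta$ is given to the algorithm beforehand. Notation: $R_i=\{v_1,\dots,v_i\}$, $V_i=N[R_i]$; $S_i$ = vertices among $v_1,\dots,v_i$ selected, $S_0=\emptyset$; $D_i=N[S_i]$; $U_i=V_i\setminus D_{i-1}$. $v_j$ saves $v_i$ if $j=\max\{k: v_k\in N[v_i]\}$ and $N[v_i]\setminus\{v_j\}$ contains no vertex of $S_{j-1}$; $s(v_j)$ is the set of vertices saved by $v_j$. The algorithm $k$-DOMINATE selects $v_i$ iff $|N(v_i)\cap U_i|\ge k$ or $|s(v_i)|\ge1$. -}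

module Defs where

open import Data.Nat using (ℕ; zero; suc; _+_; _*_; _≤_; _<_; _≤ᵇ_; _≡ᵇ_)
open import Data.Bool using (Bool; true; false; _∧_; _∨_; not; if_then_else_)
open import Data.Fin using (Fin; toℕ; _≟_)
open import Data.List using (List; map; allFin)
open import Data.Nat.ListAction using (sum)
open import Data.Bool.ListAction using (any; all)
open import Data.Product using (Σ; _×_)
open import Data.Sum using (_⊎_)
open import Relation.Nullary using (does)
open import Relation.Binary.PropositionalEquality using (_≡_)

-- The vertex u : Fin n is the vertex v_{toℕ u + 1} of the adversary's ordering,
-- i.e. the ordering of the input is the natural order of Fin n.
record Graph : Set where
  field
    n      : ℕ
    adj    : Fin n → Fin n → Bool
    sym    : ∀ u v → adj u v ≡ adj v u
    irrefl : ∀ u → adj u u ≡ false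

module _ (G : Graph) where
  open Graph G

  count : (Fin n → Bool) → ℕ
  count f = sum (map (λ x → if f x then 1 else 0) (allFin n))

  inN : Fin n → Fin n → Bool
  inN u w = does (u ≟ w) ∨ adj u w

  degree : Fin n → ℕ
  degree v = count (adj v)

  MaxDegree : ℕ → Set
  MaxDegree Δ = ∀ v → degree v ≤ Δ

  data Walk (P : Fin n → Set) : Fin n → Fin n → Set where
    here : ∀ {u} → P u → Walk P u u
    step : ∀ {u w v} → P u → adj u w ≡ true → Walk P w v → Walk P u v

  ConnectedOn : (Fin n → Set) → Set
  ConnectedOn P = ∀ u v → P u → P v → Walk P u v

  -- valid online input: nonempty, and every prefix {v_1,…,v_i} induces a
  -- connected subgraph (for i = n this is connectivity of G)
  ValidInput : Set
  ValidInput = (1 ≤ n) × (∀ i → i ≤ n → ConnectedOn (λ u → toℕ u < i))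

  IsDominating : (Fin n → Bool) → Set
  IsDominating D = ∀ u → Σ (Fin n) λ w → (u ≡ w ⊎ adj u w ≡ true) × D w ≡ true

  IsOPT : ℕ → Set
  IsOPT opt = (Σ (Fin n → Bool) λ D → IsDominating D × count D ≡ opt)
            × (∀ D → IsDominating D → opt ≤ count D)

  dominatedBy : (Fin n → Bool) → Fin n → Bool
  dominatedBy S u = any (λ w → inN u w ∧ S w) (allFin n)

  undomNbrs : (Fin n → Bool) → Fin n → ℕ
  undomNbrs S v = count (λ u → adj v u ∧ not (dominatedBy S u))

  -- |s(v)| ≥ 1, where S = S_{j-1}, v = v_j: some u ∈ N[v] with all of N[u]
  -- having index ≤ index of v (so v is the last revealed vertex of N[u]),
  -- and N[u] contains no vertex of S_{j-1}
  savesSome : (Fin n → Bool) → Fin n → Bool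
  savesSome S v = any (λ u → inN v u
                           ∧ all (λ w → not (inN u w) ∨ (toℕ w ≤ᵇ toℕ v)) (allFin n)
                           ∧ not (dominatedBy S u)) (allFin n)

  decide : ℕ → (Fin n → Bool) → Fin n → Bool
  decide k S v = (k ≤ᵇ undomNbrs S v) ∨ savesSome S v

  selectedAfter : ℕ → ℕ → Fin n → Bool
  selectedAfter k zero    v = false
  selectedAfter k (suc m) v =
    selectedAfter k m v ∨ ((toℕ v ≡ᵇ m) ∧ decide k (selectedAfter k m) v)

  ALG : ℕ → ℕ
  ALG k = count (selectedAfter k n)

IsCeilSqrt : ℕ → ℕ → Set
IsCeilSqrt Δ k = (Δ ≤ k * k) × (∀ j → Δ ≤ j * j → k ≤ j)

-- Split the vertices selected by k-DOMINATE into heavy ones (at least k undominated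
-- neighbours when revealed) and light ones (selected only because they save a vertex).
-- Each heavy selection dominates k new vertices, and each light selection saves a new
-- vertex, so k·ALG ≤ |N[S]| + k·#(vertices saved by light vertices). A closed
-- neighbourhood N[d] contains at most k vertices saved by light vertices: none if d is
-- heavy (d would already dominate them), and otherwise, apart from d itself, they are
-- undominated neighbours of d when d is revealed, of which there are fewer than k.
-- Counting over a minimum dominating set gives k·ALG ≤ (Δ + 1 + k²)·OPT, and
-- (Δ + 1 + k²)² ≤ 9Δk² for k = ⌈√Δ⌉.
module Submission where

open import Defs
open import Data.Bool using (Bool; true; false; _∧_; _∨_; not; if_then_else_)
open import Data.Bool.Properties using (T-≡; ∧-conicalˡ; ∧-conicalʳ; ∨-zeroʳ; ∨-identityʳ; not-injective)
open import Data.Bool.ListAction using (any; all)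
open import Data.Empty using (⊥; ⊥-elim)
open import Data.Fin using (Fin; zero; suc; toℕ; _≟_; fromℕ<)
open import Data.Fin.Properties using (toℕ-injective; toℕ-fromℕ<; suc-injective)
open import Data.List using (allFin; tabulate; map)
open import Data.List.Relation.Unary.Any using (satisfied)
open import Data.List.Relation.Unary.Any.Properties using (any⁺; any⁻; tabulate⁺)
open import Data.List.Relation.Unary.All.Properties using (all⁺; tabulate⁻)
open import Data.Nat using (ℕ; zero; suc; _+_; _*_; _∸_; _^_; _≤_; _<_; _≤′_; _≤ᵇ_; _≡ᵇ_;
  z≤n; s≤s; ≤′-reflexive; ≤′-step; NonZero)
import Data.Nat.ListAction as List
open import Data.Nat.Properties hiding (_≟_; suc-injective)
open import Data.Nat.Tactic.RingSolver using (solve-∀)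
open import Data.Product using (Σ; ∃; _×_; _,_; proj₁; proj₂)
open import Data.Sum using (_⊎_; inj₁; inj₂)
open import Function using (_∘_; id; case_of_)
open import Function.Bundles using (Equivalence)
open import Relation.Nullary using (yes; no; does)
open import Relation.Binary.PropositionalEquality

open import Algebra.Properties.CommutativeSemigroup +-commutativeSemigroup using (x∙yz≈y∙xz; xy∙z≈xz∙y)
open import Algebra.Properties.Semiring.Sum +-*-semiring
  using (sum; sum-syntax; ∑-comm; ∑-distrib-+; *-distribˡ-sum; *-distribʳ-sum; sum-cong-≗; sum-replicate-zero)

open Equivalence using (to; from)

true≢false : true ≢ false
true≢false ()

∧-true⁻ : ∀ {a b} → a ∧ b ≡ true → a ≡ true × b ≡ true
∧-true⁻ h = ∧-conicalˡ _ _ h , ∧-conicalʳ _ _ h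

any-allFin⁺ : ∀ {n} (p : Fin n → Bool) i → p i ≡ true → any p (allFin n) ≡ true
any-allFin⁺ p i pi = to T-≡ (any⁺ p (tabulate⁺ i (from T-≡ pi)))

any-allFin⁻ : ∀ {n} (p : Fin n → Bool) → any p (allFin n) ≡ true → ∃ λ i → p i ≡ true
any-allFin⁻ p h with satisfied (any⁻ p (allFin _) (from T-≡ h))
... | i , pi = i , to T-≡ pi

all-allFin⁻ : ∀ {n} (p : Fin n → Bool) → all p (allFin n) ≡ true → ∀ i → p i ≡ true
all-allFin⁻ p h i = to T-≡ (tabulate⁻ (all⁺ p _ (from T-≡ h)) i)

≤ᵇ-false⇒> : ∀ {m n} → (m ≤ᵇ n) ≡ false → n < m
≤ᵇ-false⇒> h = ≰⇒> λ m≤n → case trans (sym (to T-≡ (≤⇒≤ᵇ m≤n))) h of λ ()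

≡ᵇ-refl : ∀ m → (m ≡ᵇ m) ≡ true
≡ᵇ-refl m = to T-≡ (≡⇒≡ᵇ m m refl)

sum-mono-≤ : ∀ {n} {f g : Fin n → ℕ} → (∀ i → f i ≤ g i) → sum f ≤ sum g
sum-mono-≤ {zero}  _   = z≤n
sum-mono-≤ {suc n} f≤g = +-mono-≤ (f≤g zero) (sum-mono-≤ (f≤g ∘ suc))

sum-mono-< : ∀ {n} {f g : Fin n → ℕ} i → (∀ j → f j ≤ g j) → f i < g i → sum f < sum g
sum-mono-< zero    f≤g fi<gi = +-mono-<-≤ fi<gi (sum-mono-≤ (f≤g ∘ suc))
sum-mono-< (suc i) f≤g fi<gi = +-mono-≤-< (f≤g zero) (sum-mono-< i (f≤g ∘ suc) fi<gi)

sum-≤-except : ∀ {n} {f g : Fin n → ℕ} {c} i →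
  (∀ j → j ≢ i → f j ≤ g j) → f i ≤ c + g i → sum f ≤ c + sum g
sum-≤-except {g = g} {c} zero f≤g fi≤c+gi =
  ≤-trans (+-mono-≤ fi≤c+gi (sum-mono-≤ λ j → f≤g (suc j) λ ()))
          (≤-reflexive (+-assoc c (g zero) _))
sum-≤-except {g = g} {c} (suc i) f≤g fi≤c+gi =
  ≤-trans (+-mono-≤ (f≤g zero λ ()) (sum-≤-except i (λ j j≢i → f≤g (suc j) (j≢i ∘ suc-injective)) fi≤c+gi))
          (≤-reflexive (x∙yz≈y∙xz (g zero) c _))

term-≤-sum : ∀ {n} (f : Fin n → ℕ) i → f i ≤ sum f
term-≤-sum f zero    = m≤m+n (f zero) _
term-≤-sum f (suc i) = ≤-trans (term-≤-sum (f ∘ suc) i) (m≤n+m _ (f zero))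

indicator : Bool → ℕ
indicator b = if b then 1 else 0

∣_∣ : ∀ {n} → (Fin n → Bool) → ℕ
∣ P ∣ = sum (indicator ∘ P)

sum-map-tabulate : ∀ {a} {A : Set a} {n} (h : A → ℕ) (f : Fin n → A) →
  List.sum (map h (tabulate f)) ≡ sum (h ∘ f)
sum-map-tabulate {n = zero}  h f = refl
sum-map-tabulate {n = suc n} h f = cong (h (f zero) +_) (sum-map-tabulate h (f ∘ suc))

count≡∣∣ : ∀ G P → count G P ≡ ∣ P ∣
count≡∣∣ G P = sum-map-tabulate (indicator ∘ P) id

indicator-mono : ∀ {a b} → (a ≡ true → b ≡ true) → indicator a ≤ indicator b
indicator-mono {false}     _   = z≤n
indicator-mono {true}  {b} a⇒b rewrite a⇒b refl = ≤-refl

indicator-disjoint : ∀ {a b c} → (a ≡ true → b ≡ true → ⊥) → (a ≡ true → c ≡ true) → (b ≡ true → c ≡ true) →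
  indicator a + indicator b ≤ indicator c
indicator-disjoint {true}  {true}  disjoint _   _   = ⊥-elim (disjoint refl refl)
indicator-disjoint {true}  {false} _        a⇒c _   rewrite a⇒c refl = ≤-refl
indicator-disjoint {false} {true}  _        _   b⇒c rewrite b⇒c refl = ≤-refl
indicator-disjoint {false} {false} _        _   _   = z≤n

indicator≤1 : ∀ b → indicator b ≤ 1
indicator≤1 false = z≤n
indicator≤1 true  = ≤-refl

module _ {n : ℕ} where

  ∣∣-mono : {P Q : Fin n → Bool} → (∀ x → P x ≡ true → Q x ≡ true) → ∣ P ∣ ≤ ∣ Q ∣
  ∣∣-mono P⊆Q = sum-mono-≤ λ x → indicator-mono (P⊆Q x)

  ∣∣-mono-< : {P Q : Fin n → Bool} (i : Fin n) → (∀ x → P x ≡ true → Q x ≡ true) →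
    P i ≡ false → Q i ≡ true → ∣ P ∣ < ∣ Q ∣
  ∣∣-mono-< i P⊆Q Pi Qi = sum-mono-< i (λ x → indicator-mono (P⊆Q x))
                                       (subst₂ _<_ (cong indicator (sym Pi)) (cong indicator (sym Qi)) ≤-refl)

  ∣∣-≤-except : {P Q : Fin n → Bool} (i : Fin n) → (∀ x → x ≢ i → P x ≡ true → Q x ≡ true) → ∣ P ∣ ≤ suc ∣ Q ∣
  ∣∣-≤-except {P} i P⊆Q = sum-≤-except i (λ x x≢i → indicator-mono (P⊆Q x x≢i))
                                          (≤-trans (indicator≤1 (P i)) (m≤m+n 1 _))

  ∣∣-disjoint-∪ : {P Q R : Fin n → Bool} → (∀ x → P x ≡ true → Q x ≡ true → ⊥) →
    (∀ x → P x ≡ true → R x ≡ true) → (∀ x → Q x ≡ true → R x ≡ true) → ∣ P ∣ + ∣ Q ∣ ≤ ∣ R ∣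
  ∣∣-disjoint-∪ {P} {Q} {R} disjoint P⊆R Q⊆R = begin
    ∣ P ∣ + ∣ Q ∣                                ≡⟨ sym (∑-distrib-+ (indicator ∘ P) (indicator ∘ Q)) ⟩
    ∑[ x < n ] (indicator (P x) + indicator (Q x)) ≤⟨ sum-mono-≤ (λ x → indicator-disjoint (disjoint x) (P⊆R x) (Q⊆R x)) ⟩
    ∣ R ∣                                        ∎
    where open ≤-Reasoning

  ∣∣-empty : {P : Fin n → Bool} → (∀ x → P x ≡ true → ⊥) → ∣ P ∣ ≡ 0
  ∣∣-empty P-empty = n≤0⇒n≡0 (≤-trans (∣∣-mono λ x Px → ⊥-elim (P-empty x Px))
                                       (≤-reflexive (sum-replicate-zero n)))

  ∣∣-≤-cover : (P D : Fin n → Bool) (R : Fin n → Fin n → Bool) {c : ℕ} →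
    (∀ u → P u ≡ true → ∃ λ w → D w ≡ true × R u w ≡ true) →
    (∀ w → ∣ (λ u → P u ∧ R u w) ∣ ≤ c) →
    ∣ P ∣ ≤ ∣ D ∣ * c
  ∣∣-≤-cover P D R {c} covered bounded = begin
    ∣ P ∣                                                              ≤⟨ sum-mono-≤ covered-once ⟩
    ∑[ u < n ] ∑[ w < n ] (indicator (D w) * indicator (P u ∧ R u w))  ≡⟨ ∑-comm (λ u w → indicator (D w) * indicator (P u ∧ R u w)) ⟩
    ∑[ w < n ] ∑[ u < n ] (indicator (D w) * indicator (P u ∧ R u w))  ≡⟨ sum-cong-≗ (λ w → sym (*-distribˡ-sum (indicator (D w)) (λ u → indicator (P u ∧ R u w)))) ⟩
    ∑[ w < n ] (indicator (D w) * ∣ (λ u → P u ∧ R u w) ∣)              ≤⟨ sum-mono-≤ (λ w → *-monoʳ-≤ (indicator (D w)) (bounded w)) ⟩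
    ∑[ w < n ] (indicator (D w) * c)                                   ≡⟨ sym (*-distribʳ-sum c (indicator ∘ D)) ⟩
    ∣ D ∣ * c                                                          ∎
    where
    open ≤-Reasoning
    covered-once : ∀ u → indicator (P u) ≤ ∑[ w < n ] (indicator (D w) * indicator (P u ∧ R u w))
    covered-once u with P u in Pu
    ... | false = z≤n
    ... | true with covered u Pu
    ...   | w , Dw , Ruw = ≤-trans one≤term (term-≤-sum _ w)
      where
      one≤term : 1 ≤ indicator (D w) * indicator (R u w)
      one≤term rewrite Dw | Ruw = ≤-refl

module Neighbourhood (G : Graph) where
  open Graph G renaming (sym to adj-sym)

  inN-refl : ∀ u → inN G u u ≡ true
  inN-refl u with u ≟ u
  ... | yes _   = refl
  ... | no  u≢u = ⊥-elim (u≢u refl)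

  adj⇒inN : ∀ {u w} → adj u w ≡ true → inN G u w ≡ true
  adj⇒inN {u} {w} uw rewrite uw = ∨-zeroʳ (does (u ≟ w))

  inN⁻ : ∀ {u w} → inN G u w ≡ true → u ≡ w ⊎ adj u w ≡ true
  inN⁻ {u} {w} h with u ≟ w
  ... | yes u≡w = inj₁ u≡w
  ... | no  _   = inj₂ h

  inN-sym : ∀ {u w} → inN G u w ≡ true → inN G w u ≡ true
  inN-sym h with inN⁻ h
  ... | inj₁ refl = inN-refl _
  ... | inj₂ uw   = adj⇒inN (trans (adj-sym _ _) uw)

  dominatedBy⁺ : ∀ T {u w} → inN G u w ≡ true → T w ≡ true → dominatedBy G T u ≡ true
  dominatedBy⁺ T {u} {w} uw Tw = any-allFin⁺ (λ x → inN G u x ∧ T x) w (cong₂ _∧_ uw Tw)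

  dominatedBy⁻ : ∀ T {u} → dominatedBy G T u ≡ true → ∃ λ w → inN G u w ≡ true × T w ≡ true
  dominatedBy⁻ T {u} h with any-allFin⁻ (λ x → inN G u x ∧ T x) h
  ... | w , uw∧Tw = w , ∧-true⁻ uw∧Tw

  dominatedBy-mono : ∀ {T T′} → (∀ x → T x ≡ true → T′ x ≡ true) →
    ∀ {u} → dominatedBy G T u ≡ true → dominatedBy G T′ u ≡ true
  dominatedBy-mono {T} {T′} T⊆T′ h with dominatedBy⁻ T h
  ... | w , uw , Tw = dominatedBy⁺ T′ uw (T⊆T′ w Tw)

  dominator-in-closedNbhd : ∀ {D} → IsDominating G D → ∀ u → ∃ λ w → D w ≡ true × inN G u w ≡ true
  dominator-in-closedNbhd dom u with dom u
  ... | w , inj₁ refl , Dw = w , Dw , inN-refl u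
  ... | w , inj₂ uw   , Dw = w , Dw , adj⇒inN uw

  ∣closedNbhd∣≤1+Δ : ∀ {Δ} → MaxDegree G Δ → ∀ w → ∣ (λ u → inN G u w) ∣ ≤ suc Δ
  ∣closedNbhd∣≤1+Δ {Δ} maxDeg w = begin
    ∣ (λ u → inN G u w) ∣ ≤⟨ ∣∣-≤-except w (λ u u≢w uw → nbr u≢w (inN⁻ uw)) ⟩
    suc ∣ adj w ∣         ≡⟨ cong suc (sym (count≡∣∣ G (adj w))) ⟩
    suc (degree G w)      ≤⟨ s≤s (maxDeg w) ⟩
    suc Δ                 ∎
    where
    open ≤-Reasoning
    nbr : ∀ {u} → u ≢ w → u ≡ w ⊎ adj u w ≡ true → adj w u ≡ true
    nbr u≢w (inj₁ u≡w) = ⊥-elim (u≢w u≡w)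
    nbr u≢w (inj₂ uw)  = trans (adj-sym _ _) uw

  ∣∣≤∣dominating∣*1+Δ : ∀ {Δ D} → MaxDegree G Δ → IsDominating G D → ∀ P → ∣ P ∣ ≤ ∣ D ∣ * suc Δ
  ∣∣≤∣dominating∣*1+Δ maxDeg dom P =
    ∣∣-≤-cover P _ (inN G) (λ u _ → dominator-in-closedNbhd dom u)
      (λ w → ≤-trans (∣∣-mono {Q = λ u → inN G u w} (λ u → proj₂ ∘ ∧-true⁻)) (∣closedNbhd∣≤1+Δ maxDeg w))

module Run (G : Graph) (k : ℕ) where
  open Graph G renaming (sym to adj-sym)
  open Neighbourhood G

  S : ℕ → Fin n → Bool
  S = selectedAfter G k

  dominated : ℕ → Fin n → Bool
  dominated m = dominatedBy G (S m)

  heavy : Fin n → Bool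
  heavy v = k ≤ᵇ undomNbrs G (S (toℕ v)) v

  savedBy : Fin n → Fin n → Bool
  savedBy v u = inN G v u ∧ all (λ w → not (inN G u w) ∨ (toℕ w ≤ᵇ toℕ v)) (allFin n)
                          ∧ not (dominated (toℕ v) u)

  record Saves (v u : Fin n) : Set where
    field
      closed      : inN G v u ≡ true
      last        : ∀ {w} → inN G u w ≡ true → toℕ w ≤ toℕ v
      undominated : dominated (toℕ v) u ≡ false

  savedBy⁻ : ∀ {v u} → savedBy v u ≡ true → Saves v u
  savedBy⁻ {v} {u} h with ∧-true⁻ h
  ... | vu , rest with ∧-true⁻ rest
  ...   | lastᵇ , undominated = record
    { closed      = vu
    ; last        = λ {w} uw → ≤ᵇ⇒≤ _ _ (from T-≡ (subst (λ b → not b ∨ (toℕ w ≤ᵇ toℕ v) ≡ true) uw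
                                                   (all-allFin⁻ _ lastᵇ w)))
    ; undominated = not-injective undominated
    }

  savedLight : ℕ → Fin n → Bool
  savedLight m u = any (λ v → (suc (toℕ v) ≤ᵇ m) ∧ savedBy v u ∧ not (heavy v)) (allFin n)

  savedLight⁺ : ∀ {m v u} → toℕ v < m → savedBy v u ≡ true → heavy v ≡ false → savedLight m u ≡ true
  savedLight⁺ {m} {v} {u} v<m vu light =
    any-allFin⁺ _ v (cong₂ _∧_ (to T-≡ (≤⇒≤ᵇ v<m)) (cong₂ _∧_ vu (cong not light)))

  savedLight⁻ : ∀ {m u} → savedLight m u ≡ true → ∃ λ v → toℕ v < m × savedBy v u ≡ true × heavy v ≡ false
  savedLight⁻ h with any-allFin⁻ _ h
  ... | v , h′ with ∧-true⁻ h′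
  ...   | v<m , rest with ∧-true⁻ rest
  ...     | vu , light = v , ≤ᵇ⇒≤ _ _ (from T-≡ v<m) , vu , not-injective light

  S-suc : ∀ {m x} → S m x ≡ true → S (suc m) x ≡ true
  S-suc h rewrite h = refl

  S-mono : ∀ {m m′ x} → m ≤ m′ → S m x ≡ true → S m′ x ≡ true
  S-mono = go ∘ ≤⇒≤′
    where
    go : ∀ {m m′ x} → m ≤′ m′ → S m x ≡ true → S m′ x ≡ true
    go (≤′-reflexive refl)              h = h
    go {m′ = suc m′} {x} (≤′-step m≤′m′) h = S-suc {m′} {x} (go m≤′m′ h)

  S-step-accepted : ∀ {v} → decide G k (S (toℕ v)) v ≡ true → S (suc (toℕ v)) v ≡ true
  S-step-accepted {v} accepted rewrite ≡ᵇ-refl (toℕ v) | accepted = ∨-zeroʳ (S (toℕ v) v)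

  S-step-other : ∀ {v x} → x ≢ v → S (suc (toℕ v)) x ≡ S (toℕ v) x
  S-step-other {v} {x} x≢v with toℕ x ≡ᵇ toℕ v in x≡ᵇv
  ... | false = ∨-identityʳ (S (toℕ v) x)
  ... | true  = ⊥-elim (x≢v (toℕ-injective (≡ᵇ⇒≡ _ _ (from T-≡ x≡ᵇv))))

  S-step-rejected : ∀ {v} → decide G k (S (toℕ v)) v ≡ false → ∀ x → S (suc (toℕ v)) x ≡ S (toℕ v) x
  S-step-rejected {v} rejected x with x ≟ v
  ... | no x≢v  = S-step-other x≢v
  ... | yes refl rewrite ≡ᵇ-refl (toℕ v) | rejected = ∨-identityʳ (S (toℕ v) v)

  heavy⇒accepted : ∀ {v} → heavy v ≡ true → decide G k (S (toℕ v)) v ≡ true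
  heavy⇒accepted h rewrite h = refl

  dominated-mono : ∀ {m m′ u} → m ≤ m′ → dominated m u ≡ true → dominated m′ u ≡ true
  dominated-mono m≤m′ = dominatedBy-mono (λ _ → S-mono m≤m′)

  savedLight-suc : ∀ {m u} → savedLight m u ≡ true → savedLight (suc m) u ≡ true
  savedLight-suc h with savedLight⁻ h
  ... | v , v<m , vu , light = savedLight⁺ (m<n⇒m<1+n v<m) vu light

  potential : ℕ → ℕ
  potential m = ∣ dominated m ∣ + k * ∣ savedLight m ∣

  potential-suc : ∀ m → potential m ≤ potential (suc m)
  potential-suc m = +-mono-≤ (∣∣-mono λ u → dominated-mono {u = u} (n≤1+n m))
                             (*-monoʳ-≤ k (∣∣-mono λ u → savedLight-suc {u = u}))

  ∣S-step∣ : ∀ v → ∣ S (suc (toℕ v)) ∣ ≤ suc ∣ S (toℕ v) ∣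
  ∣S-step∣ v = ∣∣-≤-except v (λ x x≢v → trans (sym (S-step-other x≢v)))

  heavy-dominates-k-new : ∀ {v} → heavy v ≡ true → ∣ dominated (toℕ v) ∣ + k ≤ ∣ dominated (suc (toℕ v)) ∣
  heavy-dominates-k-new {v} h = begin
    ∣ dominated m ∣ + k     ≤⟨ +-monoʳ-≤ ∣ dominated m ∣ k≤∣U∣ ⟩
    ∣ dominated m ∣ + ∣ U ∣ ≤⟨ ∣∣-disjoint-∪ U-undominated (λ u → dominated-mono {u = u} (n≤1+n m)) U-dominated-next ⟩
    ∣ dominated (suc m) ∣   ∎
    where
    open ≤-Reasoning
    m : ℕ
    m = toℕ v
    U : Fin n → Bool
    U u = adj v u ∧ not (dominated m u)
    k≤∣U∣ : k ≤ ∣ U ∣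
    k≤∣U∣ = subst (k ≤_) (count≡∣∣ G U) (≤ᵇ⇒≤ _ _ (from T-≡ h))
    U-undominated : ∀ x → dominated m x ≡ true → U x ≡ true → ⊥
    U-undominated x dx Ux = case trans (sym (cong not dx)) (proj₂ (∧-true⁻ Ux)) of λ ()
    U-dominated-next : ∀ x → U x ≡ true → dominated (suc m) x ≡ true
    U-dominated-next x Ux = dominatedBy⁺ (S (suc m)) (adj⇒inN (trans (adj-sym x v) (proj₁ (∧-true⁻ Ux))))
                                         (S-step-accepted (heavy⇒accepted h))

  light-saves-new : ∀ {v} → heavy v ≡ false → savesSome G (S (toℕ v)) v ≡ true →
    ∣ savedLight (toℕ v) ∣ < ∣ savedLight (suc (toℕ v)) ∣
  light-saves-new {v} light saves with any-allFin⁻ (savedBy v) saves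
  ... | u , vu = ∣∣-mono-< u (λ u → savedLight-suc {u = u}) not-yet (savedLight⁺ ≤-refl vu light)
    where
    not-yet : savedLight (toℕ v) u ≡ false
    not-yet with savedLight (toℕ v) u in earlier
    ... | false = refl
    ... | true with savedLight⁻ {toℕ v} {u} earlier
    ...   | v′ , v′<v , v′u , _ =
      ⊥-elim (<⇒≱ v′<v (Saves.last (savedBy⁻ {v′} v′u) (inN-sym (Saves.closed (savedBy⁻ {v} vu)))))

  accepted-raises-potential : ∀ {v} → decide G k (S (toℕ v)) v ≡ true →
    potential (toℕ v) + k ≤ potential (suc (toℕ v))
  accepted-raises-potential {v} accepted with heavy v in h | savesSome G (S (toℕ v)) v in saves
  ... | true | _ = begin
    ∣ dominated m ∣ + k * ∣ savedLight m ∣ + k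
      ≡⟨ xy∙z≈xz∙y ∣ dominated m ∣ _ k ⟩
    ∣ dominated m ∣ + k + k * ∣ savedLight m ∣
      ≤⟨ +-mono-≤ (heavy-dominates-k-new h) (*-monoʳ-≤ k (∣∣-mono λ u → savedLight-suc {u = u})) ⟩
    potential (suc m) ∎
    where
    open ≤-Reasoning
    m : ℕ
    m = toℕ v
  ... | false | true = begin
    ∣ dominated m ∣ + k * ∣ savedLight m ∣ + k
      ≡⟨ +-assoc ∣ dominated m ∣ _ k ⟩
    ∣ dominated m ∣ + (k * ∣ savedLight m ∣ + k)
      ≡⟨ cong (∣ dominated m ∣ +_) (trans (+-comm _ k) (sym (*-suc k _))) ⟩
    ∣ dominated m ∣ + k * suc ∣ savedLight m ∣
      ≤⟨ +-mono-≤ (∣∣-mono λ u → dominated-mono {u = u} (n≤1+n m)) (*-monoʳ-≤ k (light-saves-new h saves)) ⟩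
    potential (suc m) ∎
    where
    open ≤-Reasoning
    m : ℕ
    m = toℕ v
  ... | false | false = case accepted of λ ()

  Invariant : ℕ → Set
  Invariant m = k * ∣ S m ∣ ≤ potential m

  invariant-step : ∀ v → Invariant (toℕ v) → Invariant (suc (toℕ v))
  invariant-step v inv with decide G k (S (toℕ v)) v in d
  ... | true = begin
    k * ∣ S (suc m) ∣   ≤⟨ *-monoʳ-≤ k (∣S-step∣ v) ⟩
    k * suc ∣ S m ∣     ≡⟨ *-suc k _ ⟩
    k + k * ∣ S m ∣     ≤⟨ +-monoʳ-≤ k inv ⟩
    k + potential m     ≡⟨ +-comm k _ ⟩
    potential m + k     ≤⟨ accepted-raises-potential d ⟩
    potential (suc m)   ∎
    where
    open ≤-Reasoning
    m : ℕ
    m = toℕ v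
  ... | false = begin
    k * ∣ S (suc m) ∣   ≡⟨ cong (k *_) (sum-cong-≗ (cong indicator ∘ S-step-rejected d)) ⟩
    k * ∣ S m ∣         ≤⟨ inv ⟩
    potential m         ≤⟨ potential-suc m ⟩
    potential (suc m)   ∎
    where
    open ≤-Reasoning
    m : ℕ
    m = toℕ v

  invariant : ∀ m → m ≤ n → Invariant m
  invariant zero    _   = ≤-trans (≤-reflexive (trans (cong (k *_) (sum-replicate-zero n)) (*-zeroʳ k))) z≤n
  invariant (suc m) m<n = subst (Invariant ∘ suc) (toℕ-fromℕ< m<n)
    (invariant-step (fromℕ< m<n) (subst Invariant (sym (toℕ-fromℕ< m<n)) (invariant m (<⇒≤ m<n))))

  savedLight-undominated : ∀ {m u d} → savedLight m u ≡ true → inN G u d ≡ true → dominated (toℕ d) u ≡ false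
  savedLight-undominated {m} {u} {d} h ud with savedLight⁻ {m} {u} h
  ... | v , _ , vu , _ with dominated (toℕ d) u in dominated-early
  ...   | false = refl
  ...   | true  = ⊥-elim (true≢false (trans (sym (dominated-mono (Saves.last saves ud) dominated-early))
                                             (Saves.undominated saves)))
    where
    saves : Saves v u
    saves = savedBy⁻ vu

  heavy-excludes-savedLight : ∀ {m u d} → heavy d ≡ true → savedLight m u ≡ true → inN G u d ≡ true → ⊥
  heavy-excludes-savedLight {m} {u} {d} h sl ud with savedLight⁻ {m} {u} sl
  ... | v , _ , vu , light with m≤n⇒m<n∨m≡n (Saves.last (savedBy⁻ {v} vu) ud)
  ...   | inj₂ d≡v = true≢false (trans (sym h) (trans (cong heavy (toℕ-injective d≡v)) light))
  ...   | inj₁ d<v = true≢false (trans (sym d-dominates-u) (Saves.undominated (savedBy⁻ {v} vu)))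
    where
    d-dominates-u : dominated (toℕ v) u ≡ true
    d-dominates-u = dominatedBy⁺ (S (toℕ v)) ud (S-mono d<v (S-step-accepted (heavy⇒accepted h)))

  ∣savedLight∩closedNbhd∣≤k : ∀ m d → ∣ (λ u → savedLight m u ∧ inN G u d) ∣ ≤ k
  ∣savedLight∩closedNbhd∣≤k m d with heavy d in h
  ... | true = ≤-trans (≤-reflexive (∣∣-empty none)) z≤n
    where
    none : ∀ u → savedLight m u ∧ inN G u d ≡ true → ⊥
    none u slu∧ud with ∧-true⁻ {savedLight m u} slu∧ud
    ... | slu , ud = heavy-excludes-savedLight {m} h slu ud
  ... | false = begin
    ∣ (λ u → savedLight m u ∧ inN G u d) ∣ ≤⟨ ∣∣-≤-except {Q = U} d undominated-nbr ⟩
    suc ∣ U ∣                              ≤⟨ subst (λ c → suc c ≤ k) (count≡∣∣ G U) (≤ᵇ-false⇒> h) ⟩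
    k                                      ∎
    where
    open ≤-Reasoning
    U : Fin n → Bool
    U u = adj d u ∧ not (dominated (toℕ d) u)
    undominated-nbr : ∀ u → u ≢ d → savedLight m u ∧ inN G u d ≡ true → U u ≡ true
    undominated-nbr u u≢d slu∧ud with ∧-true⁻ {savedLight m u} slu∧ud
    ... | slu , ud with inN⁻ ud
    ...   | inj₁ u≡d = ⊥-elim (u≢d u≡d)
    ...   | inj₂ adj-ud = cong₂ _∧_ (trans (adj-sym d u) adj-ud) (cong not (savedLight-undominated {m} slu ud))

  ALG-bound : ∀ {Δ D} → MaxDegree G Δ → IsDominating G D → k * ALG G k ≤ (suc Δ + k * k) * count G D
  ALG-bound {Δ} {D} maxDeg dom = begin
    k * ALG G k                             ≡⟨ cong (k *_) (count≡∣∣ G (S n)) ⟩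
    k * ∣ S n ∣                             ≤⟨ invariant n ≤-refl ⟩
    ∣ dominated n ∣ + k * ∣ savedLight n ∣  ≤⟨ +-mono-≤ (∣∣≤∣dominating∣*1+Δ maxDeg dom (dominated n))
                                                         (*-monoʳ-≤ k savedLight-bound) ⟩
    ∣ D ∣ * suc Δ + k * (∣ D ∣ * k)         ≡⟨ rearrange ∣ D ∣ Δ k ⟩
    (suc Δ + k * k) * ∣ D ∣                 ≡⟨ cong ((suc Δ + k * k) *_) (sym (count≡∣∣ G D)) ⟩
    (suc Δ + k * k) * count G D             ∎
    where
    open ≤-Reasoning
    savedLight-bound : ∣ savedLight n ∣ ≤ ∣ D ∣ * k
    savedLight-bound = ∣∣-≤-cover (savedLight n) D (inN G) (λ u _ → dominator-in-closedNbhd dom u)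
                                  (∣savedLight∩closedNbhd∣≤k n)
    rearrange : ∀ o d k → o * suc d + k * (o * k) ≡ (suc d + k * k) * o
    rearrange = solve-∀

ceilSqrt-nonZero : ∀ {Δ k} → 2 ≤ Δ → IsCeilSqrt Δ k → NonZero k
ceilSqrt-nonZero {k = zero}  2≤Δ (Δ≤0 , _) = case ≤-trans 2≤Δ Δ≤0 of λ ()
ceilSqrt-nonZero {k = suc _} _   _          = _

-- d + s stands for k² = Δ + s.
square-bound : ∀ d s → 2 ≤ d → suc s * suc s ≤ 4 * (d + s) →
  (suc d + (d + s)) * (suc d + (d + s)) ≤ 9 * d * (d + s)
square-bound d@(suc _) s 2≤d [1+s]²≤4[d+s] = begin
  (suc d + (d + s)) * (suc d + (d + s))               ≡⟨ expand d s ⟩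
  4 * (d * (d + s)) + 4 * d + suc s * suc s           ≤⟨ +-monoʳ-≤ (4 * (d * (d + s)) + 4 * d) [1+s]²≤4[d+s] ⟩
  4 * (d * (d + s)) + 4 * d + 4 * (d + s)             ≡⟨ regroup d s ⟩
  4 * (d * (d + s)) + 4 * (2 * d + s)                 ≤⟨ +-monoʳ-≤ (4 * (d * (d + s))) (*-monoʳ-≤ 4 2d+s≤d[d+s]) ⟩
  4 * (d * (d + s)) + 4 * (d * (d + s))               ≤⟨ m≤m+n _ (d * (d + s)) ⟩
  4 * (d * (d + s)) + 4 * (d * (d + s)) + d * (d + s) ≡⟨ collect d s ⟩
  9 * d * (d + s)                                     ∎
  where
  open ≤-Reasoning
  2d+s≤d[d+s] : 2 * d + s ≤ d * (d + s)
  2d+s≤d[d+s] = ≤-trans (+-mono-≤ (*-monoˡ-≤ d 2≤d) (m≤n*m s d)) (≤-reflexive (sym (*-distribˡ-+ d d s)))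
  expand : ∀ d s → (suc d + (d + s)) * (suc d + (d + s)) ≡ 4 * (d * (d + s)) + 4 * d + suc s * suc s
  expand = solve-∀
  regroup : ∀ d s → 4 * (d * (d + s)) + 4 * d + 4 * (d + s) ≡ 4 * (d * (d + s)) + 4 * (2 * d + s)
  regroup = solve-∀
  collect : ∀ d s → 4 * (d * (d + s)) + 4 * (d * (d + s)) + d * (d + s) ≡ 9 * d * (d + s)
  collect = solve-∀

ceilSqrt-bound : ∀ {Δ k} → 2 ≤ Δ → IsCeilSqrt Δ k → (suc Δ + k * k) * (suc Δ + k * k) ≤ 9 * Δ * (k * k)
ceilSqrt-bound {Δ} {zero}  2≤Δ (Δ≤0 , _) = case ≤-trans 2≤Δ Δ≤0 of λ ()
ceilSqrt-bound {Δ} {suc j} 2≤Δ (Δ≤k² , minimal) =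
  subst (λ x → (suc Δ + x) * (suc Δ + x) ≤ 9 * Δ * x) (sym k²≡Δ+s) (square-bound Δ s 2≤Δ [1+s]²≤4[Δ+s])
  where
  open ≤-Reasoning
  k s : ℕ
  k = suc j
  s = k * k ∸ Δ
  k²≡Δ+s : k * k ≡ Δ + s
  k²≡Δ+s = sym (m+[n∸m]≡n Δ≤k²)
  j²<Δ : j * j < Δ
  j²<Δ = ≰⇒> λ Δ≤j² → 1+n≰n (minimal j Δ≤j²)
  square-suc : ∀ j → suc j * suc j ≡ suc (j * j) + 2 * j
  square-suc = solve-∀
  s≤2j : s ≤ 2 * j
  s≤2j = +-cancelˡ-≤ (suc (j * j)) s (2 * j) (begin
    suc (j * j) + s     ≤⟨ +-monoˡ-≤ s j²<Δ ⟩
    Δ + s               ≡⟨ sym k²≡Δ+s ⟩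
    k * k               ≡⟨ square-suc j ⟩
    suc (j * j) + 2 * j ∎)
  1+s≤2k : suc s ≤ 2 * k
  1+s≤2k = ≤-trans (s≤s s≤2j) (≤-trans (n≤1+n _) (≤-reflexive (sym (*-suc 2 j))))
  [1+s]²≤4[Δ+s] : suc s * suc s ≤ 4 * (Δ + s)
  [1+s]²≤4[Δ+s] = begin
    suc s * suc s       ≤⟨ *-mono-≤ 1+s≤2k 1+s≤2k ⟩
    2 * k * (2 * k)     ≡⟨ double-square k ⟩
    4 * (k * k)         ≡⟨ cong (4 *_) k²≡Δ+s ⟩
    4 * (Δ + s)         ∎
    where
    double-square : ∀ k → 2 * k * (2 * k) ≡ 4 * (k * k)
    double-square = solve-∀

square-ratio : ∀ {k a b o c} .{{_ : NonZero k}} → k * a ≤ b * o → b * b ≤ c * (k * k) → a * a ≤ c * (o * o)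
square-ratio {k} {a} {b} {o} {c} ka≤bo b²≤ck² = *-cancelˡ-≤ (k * k) {{m*n≢0 k k}} (begin
  k * k * (a * a)       ≡⟨ interchange k k a a ⟩
  k * a * (k * a)       ≤⟨ *-mono-≤ ka≤bo ka≤bo ⟩
  b * o * (b * o)       ≡⟨ interchange b o b o ⟩
  b * b * (o * o)       ≤⟨ *-monoˡ-≤ (o * o) b²≤ck² ⟩
  c * (k * k) * (o * o) ≡⟨ pull-out c (k * k) (o * o) ⟩
  k * k * (c * (o * o)) ∎)
  where
  open ≤-Reasoning
  interchange : ∀ w x y z → w * x * (y * z) ≡ w * y * (x * z)
  interchange = solve-∀
  pull-out : ∀ x y z → x * y * z ≡ y * (x * z)
  pull-out = solve-∀

truncated-scaled-square : ∀ m {a o c} → a * a ≤ c * (o * o) → (m * a ∸ o) ^ 2 ≤ c * (m * o) ^ 2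
truncated-scaled-square m {a} {o} {c} a²≤co² = begin
  (m * a ∸ o) ^ 2        ≤⟨ ^-monoˡ-≤ 2 (m∸n≤m (m * a) o) ⟩
  (m * a) ^ 2            ≡⟨ square-* m a ⟩
  m * m * (a * a)        ≤⟨ *-monoʳ-≤ (m * m) a²≤co² ⟩
  m * m * (c * (o * o))  ≡⟨ rearrange m c o ⟩
  c * (m * o) ^ 2        ∎
  where
  open ≤-Reasoning
  -- x ^ 2 unfolds to x * (x * 1), which the ring solver handles.
  square-* : ∀ m a → m * a * (m * a * 1) ≡ m * m * (a * a)
  square-* = solve-∀
  rearrange : ∀ m c o → m * m * (c * (o * o)) ≡ c * (m * o * (m * o * 1))
  rearrange = solve-∀

-- N = 0 works because ALG ≤ 3√Δ·OPT holds on every input, not only asymptotically.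
theorem5 : ∀ (Δ : ℕ) → 2 ≤ Δ → ∀ (k : ℕ) → IsCeilSqrt Δ k →
    ∀ (e : ℕ) → Σ ℕ λ N →
      ∀ (G : Graph) → ValidInput G → MaxDegree G Δ →
      ∀ (opt : ℕ) → IsOPT G opt → N ≤ opt →
      (suc e * ALG G k ∸ opt) ^ 2 ≤ 9 * Δ * (suc e * opt) ^ 2
theorem5 Δ 2≤Δ k ceil e = 0 , λ where
  G _ maxDeg ._ ((D , dom , refl) , _) _ →
    truncated-scaled-square (suc e) {ALG G k} {count G D} {9 * Δ}
      (square-ratio {k} {ALG G k} {suc Δ + k * k} {count G D} {9 * Δ} {{ceilSqrt-nonZero 2≤Δ ceil}}
        (Run.ALG-bound G k maxDeg dom) (ceilSqrt-bound 2≤Δ ceil))
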